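{- If $H$ is a simple graph, then a graph $G$ contains an $H$-thorns if and only if the line graph $L(G)$ contains an $H$-minor.
   Context: Graphs are finite and may have loops and parallel edges. The line graph $L(G)$ is the simple graph with vertex set $E(G)$ in which two distinct edges are adjacent iff they share an end in $G$. For a simple graph $H$, an $H$-minor of a graph $F$ is a map $\alpha$ on $V(H)$ such that each $\alpha(h)$ is a nonempty connected subgraph of $F$, $\alpha(h_1),\alpha(h_2)$ are disjoint for distinct $h_1,h_2$, and for each edge $h_1h_2$ of $H$ there is an edge of $F$ with one end in $\alpha(h_1)$ and one in $\alpha(h_2)$. An $H$-thorns of $G$ is a map $\alpha$ on $V(H)$ such that each $\alpha(h)$ is a connected subgraph of $G$ with at least one edge, $\alpha(h_1),\alpha(h_2)$ are edge-disjoint for distinct $h_1,h_2$, and $V(\alpha(h_1))\cap V(\alpha(h_2))\ne\emptyset$ for each edge $h_1h_2$ of $H$. -}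

module Defs where

open import Data.Nat using (ℕ)
open import Data.Fin using (Fin)
open import Data.Product using (Σ; ∃; ∃-syntax; _×_; _,_; proj₁; proj₂)
open import Data.Sum using (_⊎_; inj₁; inj₂)
open import Relation.Nullary using (¬_)
open import Relation.Binary.PropositionalEquality using (_≡_; _≢_; refl; sym)

-- A (finite) graph, possibly with loops and parallel edges:
-- vertices Fin nV, edges Fin nE, each edge has two (not necessarily distinct) ends.
record Graph : Set where
  field
    nV   : ℕ
    nE   : ℕ
    ends : Fin nE → Fin nV × Fin nV

open Graph public

Inc : (G : Graph) → Fin (nE G) → Fin (nV G) → Set
Inc G e v = (proj₁ (ends G e) ≡ v) ⊎ (proj₂ (ends G e) ≡ v)

record SimpleGraph (n : ℕ) : Set₁ where
  field
    Adj    : Fin n → Fin n → Set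
    irrefl : ∀ v → ¬ Adj v v
    symm   : ∀ u v → Adj u v → Adj v u

open SimpleGraph public

record Subgraph (G : Graph) : Set₁ where
  field
    vs     : Fin (nV G) → Set
    es     : Fin (nE G) → Set
    closed : ∀ e v → es e → Inc G e v → vs v

open Subgraph public

data WalkIn {G : Graph} (S : Subgraph G) : Fin (nV G) → Fin (nV G) → Set where
  stop : ∀ {u} → WalkIn S u u
  step : ∀ {u w v} (e : Fin (nE G)) → es S e → Inc G e u → Inc G e w →
         WalkIn S w v → WalkIn S u v

Connected : {G : Graph} → Subgraph G → Set
Connected S = ∀ u v → vs S u → vs S v → WalkIn S u v

record SSubgraph {n : ℕ} (F : SimpleGraph n) : Set₁ where
  field
    svs     : Fin n → Set
    ses     : Fin n → Fin n → Set
    ses-adj : ∀ u v → ses u v → Adj F u v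
    sclosed : ∀ u v → ses u v → svs u × svs v

open SSubgraph public

data SWalkIn {n : ℕ} {F : SimpleGraph n} (S : SSubgraph F) : Fin n → Fin n → Set where
  sstop : ∀ {u} → SWalkIn S u u
  sstep : ∀ {u w v} → (ses S u w ⊎ ses S w u) → SWalkIn S w v → SWalkIn S u v

SConnected : {n : ℕ} {F : SimpleGraph n} → SSubgraph F → Set
SConnected S = ∀ u v → svs S u → svs S v → SWalkIn S u v

LAdj : (G : Graph) → Fin (nE G) → Fin (nE G) → Set
LAdj G e f = (e ≢ f) × (∃[ v ] (Inc G e v × Inc G f v))

LAdj-irrefl : (G : Graph) → ∀ e → ¬ LAdj G e e
LAdj-irrefl G e (ne , _) = ne refl

LAdj-sym : (G : Graph) → ∀ e f → LAdj G e f → LAdj G f e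
LAdj-sym G e f (ne , v , ie , jf) = (λ p → ne (sym p)) , v , jf , ie

L : (G : Graph) → SimpleGraph (nE G)
L G = record { Adj = LAdj G ; irrefl = LAdj-irrefl G ; symm = LAdj-sym G }

record Minor {k n : ℕ} (H : SimpleGraph k) (F : SimpleGraph n) : Set₁ where
  field
    α         : Fin k → SSubgraph F
    nonempty  : ∀ h → ∃[ u ] svs (α h) u
    connected : ∀ h → SConnected (α h)
    disjoint  : ∀ h₁ h₂ → h₁ ≢ h₂ → ∀ u → svs (α h₁) u → ¬ svs (α h₂) u
    edges     : ∀ h₁ h₂ → Adj H h₁ h₂ →
                ∃[ u ] ∃[ v ] (svs (α h₁) u × svs (α h₂) v × Adj F u v)

record Thorns {k : ℕ} (H : SimpleGraph k) (G : Graph) : Set₁ where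
  field
    α         : Fin k → Subgraph G
    hasEdge   : ∀ h → ∃[ e ] es (α h) e
    connected : ∀ h → Connected (α h)
    edgeDisj  : ∀ h₁ h₂ → h₁ ≢ h₂ → ∀ e → es (α h₁) e → ¬ es (α h₂) e
    touch     : ∀ h₁ h₂ → Adj H h₁ h₂ → ∃[ v ] (vs (α h₁) v × vs (α h₂) v)

module Submission where

open import Defs
open import Data.Nat using (ℕ)
open import Data.Fin using (Fin; _≟_)
open import Data.Product using (∃-syntax; _×_; _,_; proj₁; proj₂)
open import Data.Sum using (_⊎_; inj₁; inj₂)
open import Function.Bundles using (_⇔_; mk⇔)
open import Relation.Nullary using (yes; no)
open import Relation.Binary.PropositionalEquality using (_≢_; refl)

-- A connected subgraph of G with edge set X corresponds to the connected subgraph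
-- of L(G) induced on X: a walk in one is turned into a walk in the other by
-- reading off the edges it uses, since consecutive edges share an end.  Disjointness
-- of branch sets in L(G) is edge-disjointness in G, and an edge of L(G) between two
-- branch sets is a pair of edges with a common end, i.e. a common vertex.

SWalkIn-++ : ∀ {n} {F : SimpleGraph n} {S : SSubgraph F} {a b c} →
             SWalkIn S a b → SWalkIn S b c → SWalkIn S a c
SWalkIn-++ sstop       q = q
SWalkIn-++ (sstep s p) q = sstep s (SWalkIn-++ p q)

module _ {n : ℕ} {F : SimpleGraph n} (S : SSubgraph F) where

  sstep-target : ∀ {u w} → ses S u w ⊎ ses S w u → svs S w
  sstep-target {u} {w} (inj₁ s) = proj₂ (sclosed S u w s)
  sstep-target {u} {w} (inj₂ s) = proj₁ (sclosed S w u s)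

  sstep-adj : ∀ {u w} → ses S u w ⊎ ses S w u → Adj F u w
  sstep-adj {u} {w} (inj₁ s) = ses-adj S u w s
  sstep-adj {u} {w} (inj₂ s) = symm F w u (ses-adj S w u s)

module _ {G : Graph} where

  lineSubgraph : Subgraph G → SSubgraph (L G)
  lineSubgraph S = record
    { svs     = es S
    ; ses     = λ e f → es S e × es S f × LAdj G e f
    ; ses-adj = λ _ _ s → proj₂ (proj₂ s)
    ; sclosed = λ _ _ s → proj₁ s , proj₁ (proj₂ s) }

  spannedSubgraph : SSubgraph (L G) → Subgraph G
  spannedSubgraph S = record
    { vs     = λ v → ∃[ e ] (svs S e × Inc G e v)
    ; es     = svs S
    ; closed = λ e _ se ie → e , se , ie }

  module _ (S : Subgraph G) where

    common-end⇒line-walk : ∀ {e f x} → es S e → es S f → Inc G e x → Inc G f x →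
                           SWalkIn (lineSubgraph S) e f
    common-end⇒line-walk {e} {f} se sf ie if with e ≟ f
    ... | yes refl = sstop
    ... | no  e≢f  = sstep (inj₁ (se , sf , e≢f , _ , ie , if)) sstop

    walk⇒line-walk : ∀ {e f u w} → es S e → Inc G e u → WalkIn S u w → es S f → Inc G f w →
                     SWalkIn (lineSubgraph S) e f
    walk⇒line-walk se ie stop sf if = common-end⇒line-walk se sf ie if
    walk⇒line-walk se ie (step _ sg iu iw W) sf if =
      SWalkIn-++ (common-end⇒line-walk se sg ie iu) (walk⇒line-walk sg iw W sf if)

    lineSubgraph-connected : Connected S → SConnected (lineSubgraph S)
    lineSubgraph-connected conn e f se sf =
      walk⇒line-walk se (inj₁ refl) (conn _ _ (end e se) (end f sf)) sf (inj₁ refl)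
      where
      end : ∀ g → es S g → vs S (proj₁ (ends G g))
      end g sg = closed S g _ sg (inj₁ refl)

    -- The first step of a walk from v to an end of some edge is an edge at v.
    connected⇒incident-edge : Connected S → ∃[ e ] es S e → ∀ {v} → vs S v →
                              ∃[ e ] (es S e × Inc G e v)
    connected⇒incident-edge conn (e , se) sv
      with conn _ _ sv (closed S e _ se (inj₁ refl))
    ... | stop             = e , se , inj₁ refl
    ... | step g sg iv _ _ = g , sg , iv

  module _ (S : SSubgraph (L G)) where

    line-walk⇒walk : ∀ {e f u v} → svs S e → Inc G e u → SWalkIn S e f → Inc G f v →
                     WalkIn (spannedSubgraph S) u v
    line-walk⇒walk se ie sstop if = step _ se ie if stop
    line-walk⇒walk se ie (sstep s W) if with sstep-adj S s
    ... | _ , _ , ie′ , ig =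
      step _ se ie ie′ (line-walk⇒walk (sstep-target S s) ig W if)

    spannedSubgraph-connected : SConnected S → Connected (spannedSubgraph S)
    spannedSubgraph-connected conn _ _ (e , se , ie) (f , sf , if) =
      line-walk⇒walk se ie (conn e f se sf) if

module _ {k : ℕ} (H : SimpleGraph k) (G : Graph) where

  thorns⇒minor : Thorns H G → Minor H (L G)
  thorns⇒minor T = record
    { α         = λ h → lineSubgraph (α h)
    ; nonempty  = hasEdge
    ; connected = λ h → lineSubgraph-connected (α h) (connected h)
    ; disjoint  = edgeDisj
    ; edges     = touching-edges }
    where
    open Thorns T

    touching-edges : ∀ h₁ h₂ → Adj H h₁ h₂ →
                     ∃[ e ] ∃[ f ] (es (α h₁) e × es (α h₂) f × LAdj G e f)
    touching-edges h₁ h₂ a with touch h₁ h₂ a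
    ... | x , x₁ , x₂
      with connected⇒incident-edge (α h₁) (connected h₁) (hasEdge h₁) x₁
         | connected⇒incident-edge (α h₂) (connected h₂) (hasEdge h₂) x₂
    ... | e , se , ie | f , sf , if =
      e , f , se , sf , e≢f , x , ie , if
      where
      e≢f : e ≢ f
      e≢f refl = edgeDisj h₁ h₂ (λ { refl → irrefl H h₁ a }) e se sf

  minor⇒thorns : Minor H (L G) → Thorns H G
  minor⇒thorns M = record
    { α         = λ h → spannedSubgraph (α h)
    ; hasEdge   = nonempty
    ; connected = λ h → spannedSubgraph-connected (α h) (connected h)
    ; edgeDisj  = disjoint
    ; touch     = common-vertex }
    where
    open Minor M

    common-vertex : ∀ h₁ h₂ → Adj H h₁ h₂ →
                    ∃[ x ] (vs (spannedSubgraph (α h₁)) x × vs (spannedSubgraph (α h₂)) x)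
    common-vertex h₁ h₂ a with edges h₁ h₂ a
    ... | e , f , se , sf , _ , x , ie , if = x , (e , se , ie) , (f , sf , if)

lemma3p1 : ∀ {k : ℕ} (H : SimpleGraph k) (G : Graph) → Thorns H G ⇔ Minor H (L G)
lemma3p1 H G = mk⇔ (thorns⇒minor H G) (minor⇒thorns H G)
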